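{- Let $G$ be a cyclically $4$-edge-connected cubic graph and let $e$ be an edge of $G$ that is not contained in any cyclic $4$-edge-cut. Suppose that for every cyclic $4$-edge-cut $E(A,B)$ of $G$ with $e$ an edge of $G[A]$, the set $B$ is not solid. Then for every such cut, $G[B]$ is a twisted net.
   Context: Graphs may have parallel edges. For a partition $\{A,B\}$ of $V(G)$, $E(A,B)$ is the set of edges between $A$ and $B$; it is a $k$-edge-cut if it has $k$ edges, and cyclic if $G[A]$ and $G[B]$ both contain a cycle; $G$ is cyclically $4$-edge-connected if it has no cyclic edge-cut of size less than $4$. If $E(A,B)$ is a cyclic $4$-edge-cut, $B$ is solid if $G[B]$ has no $2$-edge-cut with at least two vertices on each of its sides. In a graph whose vertices have degree two or three, the vertices of degree two are called corners; in a graph consisting of a single edge, both end-vertices are corners. Twisted nets are defined inductively: a $4$-cycle is a twisted net; and if $G_0$ is a twisted net and $H$ is a twisted net or a single edge (disjoint from $G_0$), then the graph obtained from the disjoint union of $G_0$ and $H$ by adding edges $uv$ and $u'v'$, where $u,u'$ are two distinct corners of $G_0$ and $v,v'$ are two distinct corners of $H$, is a twisted net. (Graphs isomorphic to twisted nets are twisted nets.) -}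

module Defs where

open import Data.Nat using (ℕ; zero; suc; _+_; _≤_)
open import Data.Bool using (Bool; true; false; if_then_else_; not; _∧_; _xor_)
open import Data.Fin using (Fin; zero; suc; inject₁; fromℕ; _↑ˡ_; _↑ʳ_; splitAt; _≟_)
open import Data.Product using (_×_; _,_; proj₁; proj₂; Σ; ∃)
open import Data.Sum using (_⊎_; inj₁; inj₂)
open import Relation.Binary.PropositionalEquality using (_≡_; _≢_)
open import Relation.Nullary using (¬_; does)
open import Function.Definitions using (Injective)

-- Finite multigraphs: vertices Fin V, edges Fin E, each edge has an
-- (ordered, but read as unordered) pair of end-vertices.  Parallel
-- edges are allowed.  Loops are excluded by the hypothesis 'Loopless'.

record Graph : Set where
  field
    V    : ℕ
    E    : ℕ
    ends : Fin E → Fin V × Fin V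

open Graph public

Loopless : Graph → Set
Loopless G = ∀ e → proj₁ (ends G e) ≢ proj₂ (ends G e)

Joins : (G : Graph) → Fin (E G) → Fin (V G) → Fin (V G) → Set
Joins G f x y = (ends G f ≡ (x , y)) ⊎ (ends G f ≡ (y , x))

count : {m : ℕ} → (Fin m → Bool) → ℕ
count {zero}  P = 0
count {suc m} P = (if P zero then 1 else 0) + count (λ i → P (suc i))

-- edge incident with v (for loopless graphs this is the usual degree)
incidentB : (G : Graph) → Fin (V G) → Fin (E G) → Bool
incidentB G v f = does (proj₁ (ends G f) ≟ v) Data.Bool.∨ does (proj₂ (ends G f) ≟ v)

deg : (G : Graph) → Fin (V G) → ℕ
deg G v = count (incidentB G v)

Cubic : Graph → Set
Cubic G = ∀ v → deg G v ≡ 3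

VSet : Graph → Set
VSet G = Fin (V G) → Bool

compl : {G : Graph} → VSet G → VSet G
compl A v = not (A v)

-- edge f has both ends in A (i.e. f is an edge of G[A])
insideB : (G : Graph) → VSet G → Fin (E G) → Bool
insideB G A f = A (proj₁ (ends G f)) ∧ A (proj₂ (ends G f))

-- edge f lies in E(A, V∖A)
cutEdgeB : (G : Graph) → VSet G → Fin (E G) → Bool
cutEdgeB G A f = A (proj₁ (ends G f)) xor A (proj₂ (ends G f))

cutSize : (G : Graph) → VSet G → ℕ
cutSize G A = count (cutEdgeB G A)

record Cycle (G : Graph) (A : VSet G) : Set where
  field
    k      : ℕ
    k≥1    : 1 ≤ k
    vs     : Fin (suc k) → Fin (V G)
    vs-inj : Injective _≡_ _≡_ vs
    es     : Fin (suc k) → Fin (E G)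
    es-inj : Injective _≡_ _≡_ es
    step   : ∀ (i : Fin k) → Joins G (es (inject₁ i)) (vs (inject₁ i)) (vs (suc i))
    close  : Joins G (es (fromℕ k)) (vs (fromℕ k)) (vs zero)
    inA    : ∀ i → A (vs i) ≡ true

CyclicCut : (G : Graph) → VSet G → Set
CyclicCut G A = Cycle G A × Cycle G (compl {G} A)

CyclicallyFourEdgeConnected : Graph → Set
CyclicallyFourEdgeConnected G =
  ∀ (A : VSet G) → CyclicCut G A → 4 ≤ cutSize G A

Cyclic4Cut : (G : Graph) → VSet G → Set
Cyclic4Cut G A = CyclicCut G A × (cutSize G A ≡ 4)

Solid : (G : Graph) → VSet G → Set
Solid G B =
  ¬ (Σ (VSet G) λ X →
       (∀ v → X v ≡ true → B v ≡ true)
     × (2 ≤ count {V G} X)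
     × (2 ≤ count {V G} (λ v → B v ∧ not (X v)))
     × (count {E G} (λ f → insideB G B f ∧ cutEdgeB G X f) ≡ 2))

record Iso (H H' : Graph) : Set where
  field
    vmap  : Fin (V H) → Fin (V H')
    vinv  : Fin (V H') → Fin (V H)
    vinvˡ : ∀ x → vinv (vmap x) ≡ x
    vinvʳ : ∀ y → vmap (vinv y) ≡ y
    emap  : Fin (E H) → Fin (E H')
    einv  : Fin (E H') → Fin (E H)
    einvˡ : ∀ f → einv (emap f) ≡ f
    einvʳ : ∀ f → emap (einv f) ≡ f
    resp  : ∀ f → Joins H' (emap f) (vmap (proj₁ (ends H f))) (vmap (proj₂ (ends H f)))

C4 : Graph
C4 = record { V = 4 ; E = 4 ; ends = c4ends }
  where
  c4ends : Fin 4 → Fin 4 × Fin 4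
  c4ends zero                   = zero , suc zero
  c4ends (suc zero)             = suc zero , suc (suc zero)
  c4ends (suc (suc zero))       = suc (suc zero) , suc (suc (suc zero))
  c4ends (suc (suc (suc zero))) = suc (suc (suc zero)) , zero

K2 : Graph
K2 = record { V = 2 ; E = 1 ; ends = λ _ → zero , suc zero }

-- disjoint union of G0 and H plus the edges uv and u'v'
-- (vertices of G0 first, then those of H; the two new edges first)
joinG : (G0 H : Graph) → Fin (V G0) → Fin (V G0) → Fin (V H) → Fin (V H) → Graph
joinG G0 H u u' v v' = record { V = V G0 + V H ; E = suc (suc (E G0 + E H)) ; ends = js }
  where
  js : Fin (suc (suc (E G0 + E H))) → Fin (V G0 + V H) × Fin (V G0 + V H)
  js zero = (u ↑ˡ V H) , (V G0 ↑ʳ v)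
  js (suc zero) = (u' ↑ˡ V H) , (V G0 ↑ʳ v')
  js (suc (suc f)) with splitAt (E G0) f
  ... | inj₁ f0 = (proj₁ (ends G0 f0) ↑ˡ V H) , (proj₂ (ends G0 f0) ↑ˡ V H)
  ... | inj₂ f1 = (V G0 ↑ʳ proj₁ (ends H f1)) , (V G0 ↑ʳ proj₂ (ends H f1))

-- corners of a twisted net (all of whose vertices have degree 2 or 3)
Corner : (G : Graph) → Fin (V G) → Set
Corner G v = deg G v ≡ 2

data TwistedNet : Graph → Set where
  c4       : TwistedNet C4
  iso      : ∀ {H H'} → TwistedNet H → Iso H H' → TwistedNet H'
  joinNet  : ∀ {G0 H} → TwistedNet G0 → TwistedNet H →
             (u u' : Fin (V G0)) → u ≢ u' → Corner G0 u → Corner G0 u' →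
             (v v' : Fin (V H)) → v ≢ v' → Corner H v → Corner H v' →
             TwistedNet (joinG G0 H u u' v v')
  -- H a single edge: both of its end-vertices are corners
  joinEdge : ∀ {G0} → TwistedNet G0 →
             (u u' : Fin (V G0)) → u ≢ u' → Corner G0 u → Corner G0 u' →
             (v v' : Fin 2) → v ≢ v' →
             TwistedNet (joinG G0 K2 u u' v v')

record IsoInduced (H G : Graph) (B : VSet G) : Set where
  field
    vmap     : Fin (V H) → Fin (V G)
    vmap-inj : Injective _≡_ _≡_ vmap
    vmap-in  : ∀ x → B (vmap x) ≡ true
    vmap-on  : ∀ y → B y ≡ true → ∃ λ x → vmap x ≡ y
    emap     : Fin (E H) → Fin (E G)
    emap-inj : Injective _≡_ _≡_ emap
    emap-on  : ∀ f → insideB G B f ≡ true → ∃ λ g → emap g ≡ f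
    resp     : ∀ f → Joins G (emap f) (vmap (proj₁ (ends H f))) (vmap (proj₂ (ends H f)))

InducedTwistedNet : (G : Graph) → VSet G → Set
InducedTwistedNet G B = Σ Graph λ H → TwistedNet H × IsoInduced H G B

module Submission where

-- The proof is by induction on |B|.  As B is not solid, G[B] has a 2-edge-cut
-- E(X, Y) with |X|, |Y| ≥ 2.  Counting, |∂X| + |∂Y| = |∂A| + 2·2 = 8, and by
-- cyclic 4-edge-connectivity both are at least 4, hence exactly 4.  A side with
-- two vertices induces a single edge.  A side X with at least three vertices
-- contains a cycle (an acyclic S has |∂S| ≥ |S| + 2), so E(V∖X, X) is a smaller
-- cyclic 4-edge-cut with e on its near side; by induction G[X] is a twisted net,
-- in which the two ends of the crossing edges are distinct corners.  Gluing the
-- two sides along the crossing edges shows that G[B] is a twisted net; two single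
-- edges glue to a 4-cycle.

open import Defs
open import Data.Bool using (Bool; true; false; if_then_else_; not; _∧_; _∨_; _xor_)
import Data.Bool as Bool
open import Data.Bool.Properties
  using (∧-identityʳ; ∧-zeroʳ; ∧-conicalˡ; ∧-conicalʳ; ∧-comm; ∨-comm; ∨-zeroʳ; ∨-identityʳ; not-involutive)
open import Data.Empty using (⊥-elim)
open import Data.Fin using (Fin; zero; suc; _≟_; toℕ; fromℕ; fromℕ<; inject₁; splitAt; join; _↑ˡ_; _↑ʳ_)
open import Data.Fin.Properties
  using (pigeonhole; any?; all?; toℕ-fromℕ<; toℕ-inject₁; toℕ-fromℕ; toℕ-injective; toℕ<n;
         splitAt-↑ˡ; splitAt-↑ʳ; join-splitAt)
  renaming (suc-injective to fsuc-injective; 0≢1+n to fzero≢fsuc)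
open import Data.Fin.Subset.Properties using (anySubset?)
open import Data.Nat using (ℕ; zero; suc; _+_; _*_; _≤_; _<_; _≤?_; z≤n; s≤s)
import Data.Nat as ℕ
open import Data.Nat.Properties hiding (_≟_)
open import Algebra.Properties.CommutativeSemigroup +-commutativeSemigroup using (interchange)
open import Data.Product using (_×_; _,_; proj₁; proj₂; Σ; ∃)
open import Data.Sum using (_⊎_; inj₁; inj₂)
open import Data.Vec using (lookup; tabulate)
open import Data.Vec.Properties using (lookup∘tabulate)
open import Function.Definitions using (Injective)
open import Relation.Binary.Definitions using (tri<; tri≈; tri>)
open import Relation.Binary.PropositionalEquality
  using (_≡_; refl; sym; trans; cong; cong₂; subst; subst₂; module ≡-Reasoning)
open import Relation.Nullary using (¬_; Dec; does; yes; no)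
open import Relation.Nullary.Decidable using (dec-true; dec-false; _×-dec_; _→-dec_)

-- Counting.  'count P' is the number of elements of Fin m satisfying P.
-- Counts are sums of indicator values, so an identity between counts
-- follows from the same identity at every single point.

ind : Bool → ℕ
ind b = if b then 1 else 0

total : {m : ℕ} → (Fin m → ℕ) → ℕ
total {zero}  f = 0
total {suc m} f = f zero + total (λ i → f (suc i))

count-total : {m : ℕ} (P : Fin m → Bool) → count P ≡ total (λ i → ind (P i))
count-total {zero}  P = refl
count-total {suc m} P = cong (ind (P zero) +_) (count-total (λ i → P (suc i)))

total-ext : {m : ℕ} {f g : Fin m → ℕ} → (∀ i → f i ≡ g i) → total f ≡ total g
total-ext {zero}  h = refl
total-ext {suc m} h = cong₂ _+_ (h zero) (total-ext (λ i → h (suc i)))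

total-+ : {m : ℕ} (f g : Fin m → ℕ) → total (λ i → f i + g i) ≡ total f + total g
total-+ {zero}  f g = refl
total-+ {suc m} f g =
  trans (cong (f zero + g zero +_) (total-+ (λ i → f (suc i)) (λ i → g (suc i))))
        (interchange (f zero) (g zero) _ _)

total-linear : {m : ℕ} (f g h k : Fin m → ℕ) → (∀ i → f i + g i ≡ h i + k i) →
  total f + total g ≡ total h + total k
total-linear f g h k pt = begin
  total f + total g            ≡⟨ total-+ f g ⟨
  total (λ i → f i + g i)      ≡⟨ total-ext pt ⟩
  total (λ i → h i + k i)      ≡⟨ total-+ h k ⟩
  total h + total k            ∎
  where open ≡-Reasoning

count-ext : {m : ℕ} {P Q : Fin m → Bool} → (∀ i → P i ≡ Q i) → count P ≡ count Q
count-ext {zero}  h = refl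
count-ext {suc m} h = cong₂ _+_ (cong ind (h zero)) (count-ext (λ i → h (suc i)))

count-linear : {m : ℕ} (P Q R S : Fin m → Bool) →
  (∀ i → ind (P i) + ind (Q i) ≡ ind (R i) + ind (S i)) →
  count P + count Q ≡ count R + count S
count-linear P Q R S pt
  rewrite count-total P | count-total Q | count-total R | count-total S =
  total-linear _ _ _ _ pt

total-scale : {m : ℕ} (c : ℕ) (f : Fin m → ℕ) → total (λ i → c * f i) ≡ c * total f
total-scale {zero}  c f = sym (*-zeroʳ c)
total-scale {suc m} c f =
  trans (cong (c * f zero +_) (total-scale c (λ i → f (suc i))))
        (sym (*-distribˡ-+ c (f zero) _))

count-linear₂ : {m : ℕ} (P Q R S : Fin m → Bool) →
  (∀ i → ind (P i) + 2 * ind (Q i) ≡ ind (R i) + ind (S i)) →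
  count P + 2 * count Q ≡ count R + count S
count-linear₂ P Q R S pt
  rewrite count-total P | count-total Q | count-total R | count-total S =
  trans (cong (total (λ i → ind (P i)) +_) (sym (total-scale 2 (λ i → ind (Q i)))))
        (total-linear _ _ _ _ pt)

count-none : {m : ℕ} (P : Fin m → Bool) → (∀ i → P i ≡ false) → count P ≡ 0
count-none {zero}  P h = refl
count-none {suc m} P h rewrite h zero = count-none (λ i → P (suc i)) (λ i → h (suc i))

count-partition : {m : ℕ} (P Q R : Fin m → Bool) → (∀ i → ind (P i) + ind (Q i) ≡ ind (R i)) →
  count P + count Q ≡ count R
count-partition {m} P Q R pt = begin
  count P + count Q                   ≡⟨ count-linear P Q R (λ _ → false) (λ i → trans (pt i) (sym (+-identityʳ _))) ⟩
  count R + count {m} (λ _ → false)   ≡⟨ cong (count R +_) (count-none {m} _ (λ _ → refl)) ⟩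
  count R + 0                         ≡⟨ +-identityʳ _ ⟩
  count R                             ∎
  where open ≡-Reasoning

count-mono : {m : ℕ} (P Q : Fin m → Bool) → (∀ i → P i ≡ true → Q i ≡ true) → count P ≤ count Q
count-mono {zero}  P Q h = z≤n
count-mono {suc m} P Q h with P zero in p0 | Q zero in q0
... | true  | true  = s≤s (count-mono _ _ (λ i → h (suc i)))
... | true  | false with () ← trans (sym (h zero p0)) q0
... | false | true  = m≤n⇒m≤1+n (count-mono _ _ (λ i → h (suc i)))
... | false | false = count-mono _ _ (λ i → h (suc i))

count-witness : {m : ℕ} (P : Fin m → Bool) → 1 ≤ count P → ∃ λ i → P i ≡ true
count-witness {suc m} P h with P zero in p0
... | true  = zero , p0
... | false with count-witness (λ i → P (suc i)) h
...   | i , pi = suc i , pi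

_=ᵇ_ : {m : ℕ} → Fin m → Fin m → Bool
x =ᵇ y = does (x ≟ y)

=ᵇ-sound : {m : ℕ} {x y : Fin m} → x =ᵇ y ≡ true → x ≡ y
=ᵇ-sound {x = x} {y} h with x ≟ y
... | yes p = p

=ᵇ-refl : {m : ℕ} (x : Fin m) → x =ᵇ x ≡ true
=ᵇ-refl x = dec-true (x ≟ x) refl

=ᵇ-distinct : {m : ℕ} {x y : Fin m} → ¬ x ≡ y → x =ᵇ y ≡ false
=ᵇ-distinct {x = x} {y} = dec-false (x ≟ y)

=ᵇ-injective : {m n : ℕ} (h : Fin m → Fin n) → Injective _≡_ _≡_ h →
  ∀ a b → h a =ᵇ h b ≡ a =ᵇ b
=ᵇ-injective h h-inj a b with a ≟ b
... | yes refl = =ᵇ-refl (h a)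
... | no  a≢b  = =ᵇ-distinct (λ e → a≢b (h-inj e))

count-single : {m : ℕ} (a : Fin m) (P : Fin m → Bool) → count (λ y → y =ᵇ a ∧ P y) ≡ ind (P a)
count-single {suc m} zero P =
  trans (cong (ind (P zero) +_) (count-none {m} _ (λ i → refl))) (+-identityʳ _)
count-single {suc m} (suc a) P =
  trans (count-ext (λ i → cong (_∧ P (suc i)) (=ᵇ-suc i a))) (count-single a (λ y → P (suc y)))
  where
  =ᵇ-suc : ∀ {k} (i j : Fin k) → suc i =ᵇ suc j ≡ i =ᵇ j
  =ᵇ-suc i j with i ≟ j
  ... | yes _ = refl
  ... | no  _ = refl

remove : {m : ℕ} → (Fin m → Bool) → Fin m → (Fin m → Bool)
remove P a y = P y ∧ not (y =ᵇ a)

count-split : {m : ℕ} (Q P : Fin m → Bool) (a : Fin m) → Q a ≡ true →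
  count (λ y → Q y ∧ P y) ≡ ind (P a) + count (λ y → remove Q a y ∧ P y)
count-split Q P a qa = begin
  count (λ y → Q y ∧ P y)
    ≡⟨ count-partition _ _ _ (λ i → pointwise (Q i) (P i) (i =ᵇ a) (a-in-Q i)) ⟨
  count (λ y → y =ᵇ a ∧ P y) + count (λ y → remove Q a y ∧ P y)
    ≡⟨ cong (_+ count (λ y → remove Q a y ∧ P y)) (count-single a P) ⟩
  ind (P a) + count (λ y → remove Q a y ∧ P y) ∎
  where
  open ≡-Reasoning
  a-in-Q : ∀ i → i =ᵇ a ≡ true → Q i ≡ true
  a-in-Q i e = subst (λ z → Q z ≡ true) (sym (=ᵇ-sound e)) qa
  -- q, p: membership in Q and P; e: whether the point is a
  pointwise : ∀ q p e → (e ≡ true → q ≡ true) → ind (e ∧ p) + ind ((q ∧ not e) ∧ p) ≡ ind (q ∧ p)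
  pointwise false p     true  h with () ← h refl
  pointwise true  true  true  h = refl
  pointwise true  false true  h = refl
  pointwise false p     false h = refl
  pointwise true  p     false h = refl

count-remove : {m : ℕ} (P : Fin m → Bool) (a : Fin m) → P a ≡ true →
  count P ≡ suc (count (remove P a))
count-remove P a pa = begin
  count P                                  ≡⟨ count-ext (λ y → ∧-identityʳ (P y)) ⟨
  count (λ y → P y ∧ true)                 ≡⟨ count-split P (λ _ → true) a pa ⟩
  suc (count (λ y → remove P a y ∧ true))  ≡⟨ cong suc (count-ext (λ y → ∧-identityʳ (remove P a y))) ⟩
  suc (count (remove P a))                 ∎
  where open ≡-Reasoning

count-rest : {m k : ℕ} (P : Fin m → Bool) (a : Fin m) → P a ≡ true → count P ≡ suc k →
  count (remove P a) ≡ k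
count-rest P a pa size = suc-injective (trans (sym (count-remove P a pa)) size)

count-positive : {m : ℕ} (P : Fin m → Bool) (a : Fin m) → P a ≡ true → 1 ≤ count P
count-positive P a pa rewrite count-remove P a pa = s≤s z≤n

remove-self : {m : ℕ} (P : Fin m → Bool) (a : Fin m) → remove P a a ≡ false
remove-self P a rewrite =ᵇ-refl a = ∧-zeroʳ (P a)

remove-keeps : {m : ℕ} (P : Fin m → Bool) {a b : Fin m} → P b ≡ true → ¬ a ≡ b → remove P a b ≡ true
remove-keeps P pb a≢b rewrite pb | =ᵇ-distinct (λ e → a≢b (sym e)) = refl

count-two : {m : ℕ} (P : Fin m → Bool) (a b : Fin m) → P a ≡ true → P b ≡ true → ¬ a ≡ b →
  2 ≤ count P
count-two P a b pa pb a≢b rewrite count-remove P a pa | count-remove (remove P a) b (remove-keeps P pb a≢b) =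
  s≤s (s≤s z≤n)

count-zero : {m : ℕ} (P : Fin m → Bool) → count P ≡ 0 → ∀ i → P i ≡ false
count-zero P h i with P i in pi
... | false = refl
... | true with () ← trans (sym h) (count-remove P i pi)

count-one : {m : ℕ} (P : Fin m → Bool) → count P ≡ 1 → ∀ a b → P a ≡ true → P b ≡ true → a ≡ b
count-one P h a b pa pb with a ≟ b
... | yes a≡b = a≡b
... | no  a≢b with () ← trans (sym (count-zero (remove P a) (count-rest P a pa h) b))
                              (remove-keeps P pb a≢b)

count-two-cases : {m : ℕ} (P : Fin m → Bool) → count P ≡ 2 → ∀ a b c → P a ≡ true → P b ≡ true →
  ¬ a ≡ b → P c ≡ true → (c ≡ a) ⊎ (c ≡ b)
count-two-cases P h a b c pa pb a≢b pc with c ≟ a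
... | yes c≡a = inj₁ c≡a
... | no  c≢a = inj₂ (count-one (remove P a) (count-rest P a pa h) c b
                         (remove-keeps P pc (λ e → c≢a (sym e))) (remove-keeps P pb a≢b))

count-two-witnesses : {m : ℕ} (P : Fin m → Bool) → count P ≡ 2 →
  Σ (Fin m) λ a → Σ (Fin m) λ b → (¬ a ≡ b) × (P a ≡ true) × (P b ≡ true)
count-two-witnesses P h with count-witness P (subst (1 ≤_) (sym h) (s≤s z≤n))
... | a , pa with count-witness (remove P a) (subst (1 ≤_) (sym (count-rest P a pa h)) (s≤s z≤n))
...   | b , rb = a , b , a≢b , pa , ∧-conicalˡ (P b) _ rb
  where
  a≢b : ¬ a ≡ b
  a≢b refl with () ← trans (sym rb) (remove-self P a)

count-miss : {m : ℕ} (Q P : Fin m → Bool) (a : Fin m) → Q a ≡ true → P a ≡ false →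
  suc (count (λ y → Q y ∧ P y)) ≤ count Q
count-miss Q P a qa pa = begin
  suc (count (λ y → Q y ∧ P y))                  ≡⟨ cong suc (count-split Q P a qa) ⟩
  suc (ind (P a) + count (λ y → remove Q a y ∧ P y))
    ≡⟨ cong (λ b → suc (ind b + count (λ y → remove Q a y ∧ P y))) pa ⟩
  suc (count (λ y → remove Q a y ∧ P y))
    ≤⟨ s≤s (count-mono (λ y → remove Q a y ∧ P y) (remove Q a) (λ y h → ∧-conicalˡ _ _ h)) ⟩
  suc (count (remove Q a))                       ≡⟨ count-remove Q a qa ⟨
  count Q                                        ∎
  where open ≤-Reasoning

count-image : {p q : ℕ} (h : Fin p → Fin q) → Injective _≡_ _≡_ h → (Q : Fin q → Bool) →
  (∀ x → Q (h x) ≡ true) → (∀ y → Q y ≡ true → ∃ λ x → h x ≡ y) → (P : Fin q → Bool) →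
  count (λ x → P (h x)) ≡ count (λ y → Q y ∧ P y)
count-image {zero} h h-inj Q h-in h-onto P = sym (count-none _ outside)
  where
  outside : ∀ y → Q y ∧ P y ≡ false
  outside y with Q y in qy
  ... | false = refl
  ... | true with () ← proj₁ (h-onto y qy)
count-image {suc p} h h-inj Q h-in h-onto P = begin
  ind (P (h zero)) + count (λ x → P (h (suc x)))
    ≡⟨ cong (ind (P (h zero)) +_) (count-image (λ x → h (suc x)) (λ e → fsuc-injective (h-inj e))
                                              (remove Q (h zero)) in' onto' P) ⟩
  ind (P (h zero)) + count (λ y → remove Q (h zero) y ∧ P y)
    ≡⟨ count-split Q P (h zero) (h-in zero) ⟨
  count (λ y → Q y ∧ P y) ∎
  where
  open ≡-Reasoning
  in' : ∀ x → remove Q (h zero) (h (suc x)) ≡ true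
  in' x = remove-keeps Q (h-in (suc x)) (λ e → fzero≢fsuc (h-inj e))
  onto' : ∀ y → remove Q (h zero) y ≡ true → ∃ λ x → h (suc x) ≡ y
  onto' y r with h-onto y (∧-conicalˡ _ _ r)
  ... | suc x , e = x , e
  ... | zero  , refl with () ← trans (sym r) (remove-self Q (h zero))

least : (R : ℕ → Set) → (∀ n → Dec (R n)) → ∀ N → R N →
  Σ ℕ λ b → R b × (∀ b' → b' < b → ¬ R b')
least R R? N rN with search (suc N)
  where
  search : ∀ N → (∀ b → b < N → ¬ R b) ⊎ (Σ ℕ λ b → R b × (∀ b' → b' < b → ¬ R b'))
  search zero = inj₁ (λ b ())
  search (suc N) with search N
  ... | inj₂ found = inj₂ found
  ... | inj₁ none with R? N
  ...   | yes rN = inj₂ (N , rN , none)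
  ...   | no ¬rN = inj₁ below
    where
    below : ∀ b → b < suc N → ¬ R b
    below b (s≤s b≤N) with m≤n⇒m<n∨m≡n b≤N
    ... | inj₁ b<N = none b b<N
    ... | inj₂ refl = ¬rN
... | inj₁ none = ⊥-elim (none N ≤-refl rN)
... | inj₂ found = found

disjoint-sym : {m : ℕ} {P Q : Fin m → Bool} → (∀ i → P i ≡ true → Q i ≡ false) →
  ∀ i → Q i ≡ true → P i ≡ false
disjoint-sym {P = P} P∩Q i qi with P i in pi
... | false = refl
... | true with () ← trans (sym qi) (P∩Q i pi)

module GraphFacts (G : Graph) where

  src tgt : Fin (E G) → Fin (V G)
  src f = proj₁ (ends G f)
  tgt f = proj₂ (ends G f)

  joins-sym : ∀ {f a b} → Joins G f a b → Joins G f b a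
  joins-sym (inj₁ p) = inj₂ p
  joins-sym (inj₂ p) = inj₁ p

  joins-unique : ∀ {f a b c d} → Joins G f a b → Joins G f c d →
    ((a ≡ c) × (b ≡ d)) ⊎ ((a ≡ d) × (b ≡ c))
  joins-unique (inj₁ p) (inj₁ q) with refl ← trans (sym p) q = inj₁ (refl , refl)
  joins-unique (inj₁ p) (inj₂ q) with refl ← trans (sym p) q = inj₂ (refl , refl)
  joins-unique (inj₂ p) (inj₁ q) with refl ← trans (sym p) q = inj₂ (refl , refl)
  joins-unique (inj₂ p) (inj₂ q) with refl ← trans (sym p) q = inj₁ (refl , refl)

  joins-distinct : Loopless G → ∀ {f a b} → Joins G f a b → ¬ a ≡ b
  joins-distinct loopless {f} (inj₁ refl) a≡b = loopless f a≡b
  joins-distinct loopless {f} (inj₂ refl) a≡b = loopless f (sym a≡b)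

  joins-inside⇒ : ∀ {f a b} (S : VSet G) → Joins G f a b → insideB G S f ≡ true →
    (S a ≡ true) × (S b ≡ true)
  joins-inside⇒ S (inj₁ refl) h = ∧-conicalˡ _ _ h , ∧-conicalʳ _ _ h
  joins-inside⇒ S (inj₂ refl) h = ∧-conicalʳ _ _ h , ∧-conicalˡ _ _ h

  joins-inside⇐ : ∀ {f a b} (S : VSet G) → Joins G f a b → S a ≡ true → S b ≡ true →
    insideB G S f ≡ true
  joins-inside⇐ S (inj₁ refl) sa sb rewrite sa | sb = refl
  joins-inside⇐ S (inj₂ refl) sa sb rewrite sa | sb = refl

  joins-leaves : ∀ {f a b} (S : VSet G) → Joins G f a b → S b ≡ false → insideB G S f ≡ false
  joins-leaves S (inj₁ refl) sb rewrite sb = ∧-zeroʳ _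
  joins-leaves S (inj₂ refl) sb rewrite sb = refl

  inside-disjoint : (S T : VSet G) → (∀ v → S v ≡ true → T v ≡ false) →
    ∀ f → insideB G S f ≡ true → insideB G T f ≡ false
  inside-disjoint S T S∩T f h rewrite S∩T (src f) (∧-conicalˡ _ _ h) = refl

  joins-incident : ∀ {f a b} → Joins G f a b → incidentB G a f ≡ true
  joins-incident {a = a} (inj₁ refl) rewrite =ᵇ-refl a = refl
  joins-incident {a = a} (inj₂ refl) rewrite =ᵇ-refl a = ∨-zeroʳ _

  other : Fin (E G) → Fin (V G) → Fin (V G)
  other f v = if src f =ᵇ v then tgt f else src f

  joins-other : (f : Fin (E G)) (v : Fin (V G)) → incidentB G v f ≡ true → Joins G f v (other f v)
  joins-other f v h with src f =ᵇ v in e₁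
  ... | true = inj₁ (cong (_, tgt f) (=ᵇ-sound e₁))
  ... | false with tgt f =ᵇ v in e₂
  ...   | true = inj₂ (cong (src f ,_) (=ᵇ-sound e₂))
  joins-other f v () | false | false

  cycle-mono : (S T : VSet G) → (∀ v → S v ≡ true → T v ≡ true) → Cycle G S → Cycle G T
  cycle-mono S T S⊆T c = record
    { k = k ; k≥1 = k≥1 ; vs = vs ; vs-inj = vs-inj ; es = es ; es-inj = es-inj
    ; step = step ; close = close ; inA = λ i → S⊆T _ (inA i) }
    where open Cycle c

  iso-ext : {H : Graph} {S T : VSet G} → IsoInduced H G S → (∀ v → S v ≡ T v) → IsoInduced H G T
  iso-ext {S = S} {T} I S≗T = record
    { vmap = vmap ; vmap-inj = vmap-inj ; vmap-in = λ x → trans (sym (S≗T _)) (vmap-in x)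
    ; vmap-on = λ y t → vmap-on y (trans (S≗T y) t)
    ; emap = emap ; emap-inj = emap-inj
    ; emap-on = λ f t → emap-on f (trans (cong₂ _∧_ (S≗T (src f)) (S≗T (tgt f))) t)
    ; resp = resp }
    where open IsoInduced I

  degIn : VSet G → Fin (V G) → ℕ
  degIn S v = count (λ f → insideB G S f ∧ incidentB G v f)

  deg-iso : {H : Graph} {S : VSet G} (I : IsoInduced H G S) → ∀ x → deg H x ≡ degIn S (IsoInduced.vmap I x)
  deg-iso {H} {S} I x = trans (count-ext incident-iso)
    (count-image emap emap-inj (insideB G S) emap-inside emap-on (incidentB G (vmap x)))
    where
    open IsoInduced I
    emap-inside : ∀ f → insideB G S (emap f) ≡ true
    emap-inside f = joins-inside⇐ S (resp f) (vmap-in _) (vmap-in _)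
    incident-iso : ∀ f → incidentB H x f ≡ incidentB G (vmap x) (emap f)
    incident-iso f with resp f
    ... | inj₁ p rewrite p =
      sym (cong₂ _∨_ (=ᵇ-injective vmap vmap-inj _ x) (=ᵇ-injective vmap vmap-inj _ x))
    ... | inj₂ p rewrite p =
      trans (∨-comm (proj₁ (ends H f) =ᵇ x) _)
            (sym (cong₂ _∨_ (=ᵇ-injective vmap vmap-inj _ x) (=ᵇ-injective vmap vmap-inj _ x)))

  cut-ext : (S T : VSet G) → (∀ v → S v ≡ T v) → cutSize G S ≡ cutSize G T
  cut-ext S T S≗T = count-ext (λ f → cong₂ _xor_ (S≗T (src f)) (S≗T (tgt f)))

  cut-compl : (S : VSet G) → cutSize G (compl {G} S) ≡ cutSize G S
  cut-compl S = count-ext (λ f → not-xor-not (S (src f)) (S (tgt f)))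
    where
    not-xor-not : ∀ a b → not a xor not b ≡ a xor b
    not-xor-not true  b = refl
    not-xor-not false b = not-involutive b

  cut-empty : (S : VSet G) → (∀ v → S v ≡ false) → cutSize G S ≡ 0
  cut-empty S h = count-none _ (λ f → cong₂ _xor_ (h (src f)) (h (tgt f)))

  -- For X ⊆ V∖A and Y = V∖(A ∪ X), every edge of E(X, Y) lies in both ∂X and
  -- ∂Y, and every other edge of ∂X ∪ ∂Y lies in exactly one of them and in ∂A:
  -- |∂A| + 2·|E(X, Y)| = |∂X| + |∂Y|.
  cut-three-parts : (A X : VSet G) → (∀ v → X v ≡ true → A v ≡ false) →
    cutSize G A + 2 * count (λ f → insideB G (compl {G} A) f ∧ cutEdgeB G X f)
      ≡ cutSize G X + cutSize G (λ v → not (A v) ∧ not (X v))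
  cut-three-parts A X X∩A = count-linear₂ _ _ _ _ (λ f →
    local (A (src f)) (A (tgt f)) (X (src f)) (X (tgt f)) (X∩A (src f)) (X∩A (tgt f)))
    where
    local : ∀ a₁ a₂ x₁ x₂ → (x₁ ≡ true → a₁ ≡ false) → (x₂ ≡ true → a₂ ≡ false) →
      ind (a₁ xor a₂) + 2 * ind ((not a₁ ∧ not a₂) ∧ (x₁ xor x₂))
        ≡ ind (x₁ xor x₂) + ind ((not a₁ ∧ not x₁) xor (not a₂ ∧ not x₂))
    local true  a₂    true  x₂    h₁ _  with () ← h₁ refl
    local a₁    true  x₁    true  _  h₂ with () ← h₂ refl
    local true  true  false false _  _  = refl
    local true  false false true  _  _  = refl
    local true  false false false _  _  = refl
    local false true  true  false _  _  = refl
    local false true  false false _  _  = refl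
    local false false true  true  _  _  = refl
    local false false true  false _  _  = refl
    local false false false true  _  _  = refl
    local false false false false _  _  = refl

module LooplessFacts (G : Graph) (loopless : Loopless G) where
  open GraphFacts G

  degIn-single : (S : VSet G) → count S ≡ 1 → (v : Fin (V G)) → S v ≡ true → degIn S v ≡ 0
  degIn-single S one v sv = count-none _ no-edge
    where
    no-edge : ∀ f → insideB G S f ∧ incidentB G v f ≡ false
    no-edge f with S (src f) in s₁ | S (tgt f) in s₂
    ... | false | _     = refl
    ... | true  | false = refl
    ... | true  | true  = ⊥-elim (loopless f (trans (count-one S one _ _ s₁ sv) (sym (count-one S one _ _ s₂ sv))))

  two-vertex-joins : (S : VSet G) → count S ≡ 2 → (p q : Fin (V G)) → ¬ p ≡ q →
    S p ≡ true → S q ≡ true → ∀ f → insideB G S f ≡ true → Joins G f p q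
  two-vertex-joins S two p q p≢q sp sq f h
    with p-or-q (src f) (∧-conicalˡ _ _ h) | p-or-q (tgt f) (∧-conicalʳ _ _ h)
    where
    p-or-q : ∀ v → S v ≡ true → (v ≡ p) ⊎ (v ≡ q)
    p-or-q v sv = count-two-cases S two p q v sp sq p≢q sv
  ... | inj₁ a | inj₁ b = ⊥-elim (loopless f (trans a (sym b)))
  ... | inj₁ a | inj₂ b = inj₁ (cong₂ _,_ a b)
  ... | inj₂ a | inj₁ b = inj₂ (cong₂ _,_ a b)
  ... | inj₂ a | inj₂ b = ⊥-elim (loopless f (trans a (sym b)))

  -- If every vertex of G[S] has degree at least two, walking along G[S]
  -- without reversing the last edge eventually revisits a vertex; the walk
  -- between the first revisit and the earlier visit of that vertex is a cycle.
  module MinDegreeTwo (S : VSet G) (deg≥2 : ∀ v → S v ≡ true → 2 ≤ degIn S v) where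

    At : Fin (V G) → Fin (E G) → Bool
    At v g = insideB G S g ∧ incidentB G v g

    another-edge : (v : Fin (V G)) → S v ≡ true → (f : Fin (E G)) →
      Σ (Fin (E G)) λ g → (¬ g ≡ f) × (At v g ≡ true)
    another-edge v sv f with count-witness (λ g → remove (λ _ → true) f g ∧ At v g) rest≥1
      where
      rest≥1 : 1 ≤ count (λ g → remove (λ _ → true) f g ∧ At v g)
      rest≥1 = +-cancelˡ-≤ 1 1 _ (begin
        2                                                          ≤⟨ deg≥2 v sv ⟩
        degIn S v                                                  ≡⟨ count-split (λ _ → true) (At v) f refl ⟩
        ind (At v f) + count (λ g → remove (λ _ → true) f g ∧ At v g) ≤⟨ +-monoˡ-≤ _ (ind≤1 (At v f)) ⟩
        1 + count (λ g → remove (λ _ → true) f g ∧ At v g)         ∎)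
        where
        open ≤-Reasoning
        ind≤1 : ∀ b → ind b ≤ 1
        ind≤1 true  = ≤-refl
        ind≤1 false = z≤n
    ... | g , pg = g , g≢f , ∧-conicalʳ (not (g =ᵇ f)) (At v g) pg
      where
      g≢f : ¬ g ≡ f
      g≢f refl with () ← trans (sym (∧-conicalˡ (remove (λ _ → true) g g) (At v g) pg)) (remove-self (λ _ → true) g)

    -- a position of the walk: a vertex of S and the edge of G[S] to leave it by
    record Position : Set where
      field
        here  : Fin (V G)
        edge  : Fin (E G)
        in-S  : S here ≡ true
        at    : At here edge ≡ true

    advance : Position → Position
    advance p = record { here = next ; edge = proj₁ g ; in-S = next-in-S ; at = proj₂ (proj₂ g) }
      where
      open Position p
      next : Fin (V G)
      next = other edge here
      next-in-S : S next ≡ true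
      next-in-S = proj₂ (joins-inside⇒ S (joins-other edge here (∧-conicalʳ _ _ at)) (∧-conicalˡ _ _ at))
      g : Σ (Fin (E G)) λ g → (¬ g ≡ edge) × (At next g ≡ true)
      g = another-edge next next-in-S edge

    module FromVertex (v₀ : Fin (V G)) (s₀ : S v₀ ≡ true) where

      walk : ℕ → Position
      walk zero with count-witness (At v₀) (≤-trans (s≤s z≤n) (deg≥2 v₀ s₀))
      ... | g , pg = record { here = v₀ ; edge = g ; in-S = s₀ ; at = pg }
      walk (suc n) = advance (walk n)

      w : ℕ → Fin (V G)
      w n = Position.here (walk n)

      γ : ℕ → Fin (E G)
      γ n = Position.edge (walk n)

      γ-joins : ∀ n → Joins G (γ n) (w n) (w (suc n))
      γ-joins n = joins-other (γ n) (w n) (∧-conicalʳ _ _ (Position.at (walk n)))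

      no-backtrack : ∀ n → ¬ γ (suc n) ≡ γ n
      no-backtrack n = proj₁ (proj₂ (another-edge _ (Position.in-S (walk (suc n))) (γ n)))

      Revisit : ℕ → Set
      Revisit b = Σ (Fin b) λ a → w (toℕ a) ≡ w b

      revisit : ∀ {x y} → x < y → w x ≡ w y → Revisit y
      revisit {x} {y} x<y e = fromℕ< x<y , subst (λ z → w z ≡ w y) (sym (toℕ-fromℕ< x<y)) e

      first : Σ ℕ λ b → Revisit b × (∀ b' → b' < b → ¬ Revisit b')
      first with pigeonhole (n<1+n (V G)) (λ i → w (toℕ i))
      ... | i , j , i<j , e =
        least Revisit (λ b → any? (λ a → w (toℕ a) ≟ w b)) (toℕ j) (revisit i<j e)

      len : ℕ
      len = proj₁ first

      w-injective : ∀ x y → x < len → y < len → w x ≡ w y → x ≡ y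
      w-injective x y x<len y<len e with <-cmp x y
      ... | tri≈ _ x≡y _ = x≡y
      ... | tri< x<y _ _ = ⊥-elim (proj₂ (proj₂ first) y y<len (revisit x<y e))
      ... | tri> _ _ y<x = ⊥-elim (proj₂ (proj₂ first) x x<len (revisit y<x (sym e)))

      γ-injective : ∀ s t → s < len → t < len → γ s ≡ γ t → s ≡ t
      γ-injective s t s<len t<len e
        with joins-unique (γ-joins s) (subst (λ g → Joins G g (w t) (w (suc t))) (sym e) (γ-joins t))
      ... | inj₁ (ws≡wt , _) = w-injective s t s<len t<len ws≡wt
      ... | inj₂ (ws≡wt+1 , ws+1≡wt) with <-cmp s t
      ...   | tri≈ _ s≡t _ = s≡t
      ...   | tri< s<t _ _ with refl ← w-injective (suc s) t (≤-<-trans s<t t<len) t<len ws+1≡wt =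
                ⊥-elim (no-backtrack s (sym e))
      ...   | tri> _ _ t<s with refl ← w-injective s (suc t) s<len (≤-<-trans t<s s<len) ws≡wt+1 =
                ⊥-elim (no-backtrack t e)

      -- the closed walk w i, …, w (i + k + 1) = w len = w i
      segment : ∀ i k → len ≡ suc (i + suc k) → w i ≡ w len → Cycle G S
      segment i k len≡ wi≡ = record
        { k = suc k ; k≥1 = s≤s z≤n ; vs = vs ; vs-inj = vs-inj ; es = es ; es-inj = es-inj
        ; step = step ; close = close ; inA = λ x → Position.in-S (walk (i + toℕ x)) }
        where
        vs : Fin (suc (suc k)) → Fin (V G)
        vs x = w (i + toℕ x)
        es : Fin (suc (suc k)) → Fin (E G)
        es x = γ (i + toℕ x)
        bound : ∀ (x : Fin (suc (suc k))) → i + toℕ x < len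
        bound x = subst (i + toℕ x <_) (sym len≡) (s≤s (+-monoʳ-≤ i (≤-pred (toℕ<n x))))
        vs-inj : Injective _≡_ _≡_ vs
        vs-inj {x} {y} e = toℕ-injective (+-cancelˡ-≡ i _ _ (w-injective _ _ (bound x) (bound y) e))
        es-inj : Injective _≡_ _≡_ es
        es-inj {x} {y} e = toℕ-injective (+-cancelˡ-≡ i _ _ (γ-injective _ _ (bound x) (bound y) e))
        step : ∀ (x : Fin (suc k)) → Joins G (es (inject₁ x)) (vs (inject₁ x)) (vs (suc x))
        step x rewrite toℕ-inject₁ x | +-suc i (toℕ x) = γ-joins (i + toℕ x)
        close : Joins G (es (fromℕ (suc k))) (vs (fromℕ (suc k))) (vs zero)
        close rewrite toℕ-fromℕ (suc k) | +-identityʳ i =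
          subst (Joins G (γ (i + suc k)) (w (i + suc k))) (trans (cong w (sym len≡)) (sym wi≡))
                (γ-joins (i + suc k))

      cycle : Cycle G S
      cycle with proj₁ (proj₂ first)
      ... | a , wa≡ with m≤n⇒∃[o]m+o≡n (toℕ<n a)
      ...   | suc k , e = segment (toℕ a) k (sym e) wa≡
      ...   | zero  , e = ⊥-elim (joins-distinct loopless (γ-joins (toℕ a))
                                   (trans wa≡ (cong w (trans (sym e) (+-identityʳ _)))))

    cycle : (v₀ : Fin (V G)) → S v₀ ≡ true → Cycle G S
    cycle = FromVertex.cycle

-- Cuts in a loopless cubic graph.  The basic identity: moving a vertex v
-- out of S removes its edges to V∖S from the cut and adds its edges inside S,
-- so |∂(S∖v)| + 3 = |∂S| + 2·deg_{G[S]}(v).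
module CubicFacts (G : Graph) (loopless : Loopless G) (cubic : Cubic G) where
  open GraphFacts G
  open LooplessFacts G loopless

  cut-remove : (S : VSet G) (v : Fin (V G)) → S v ≡ true →
    cutSize G S + 2 * degIn S v ≡ cutSize G (remove S v) + 3
  cut-remove S v sv = trans
    (count-linear₂ _ _ _ _ (λ f → local (S (src f)) (S (tgt f)) (src f =ᵇ v) (tgt f =ᵇ v) at-v at-v (not-both f)))
    (cong (cutSize G (remove S v) +_) (cubic v))
    where
    at-v : ∀ {x} → x =ᵇ v ≡ true → S x ≡ true
    at-v e = subst (λ z → S z ≡ true) (sym (=ᵇ-sound e)) sv
    not-both : ∀ f → src f =ᵇ v ∧ tgt f =ᵇ v ≡ false
    not-both f with src f =ᵇ v in e₁ | tgt f =ᵇ v in e₂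
    ... | true  | true  = ⊥-elim (loopless f (trans (=ᵇ-sound e₁) (sym (=ᵇ-sound e₂))))
    ... | true  | false = refl
    ... | false | _     = refl
    -- sa, sb: membership of the ends in S; ea, eb: whether the ends are v
    local : ∀ sa sb ea eb → (ea ≡ true → sa ≡ true) → (eb ≡ true → sb ≡ true) → ea ∧ eb ≡ false →
      ind (sa xor sb) + 2 * ind ((sa ∧ sb) ∧ (ea ∨ eb))
        ≡ ind ((sa ∧ not ea) xor (sb ∧ not eb)) + ind (ea ∨ eb)
    local sa    sb    true  true  _  _  ()
    local sa    true  true  false h₁ _  _ rewrite h₁ refl = refl
    local sa    false true  false h₁ _  _ rewrite h₁ refl = refl
    local true  sb    false true  _  h₂ _ rewrite h₂ refl = refl
    local false sb    false true  _  h₂ _ rewrite h₂ refl = refl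
    local true  true  false false _  _  _ = refl
    local true  false false false _  _  _ = refl
    local false true  false false _  _  _ = refl
    local false false false false _  _  _ = refl

  cut-singleton : (S : VSet G) → count S ≡ 1 → (v : Fin (V G)) → S v ≡ true → cutSize G S ≡ 3
  cut-singleton S one v sv = begin
    cutSize G S                                 ≡⟨ +-identityʳ _ ⟨
    cutSize G S + 2 * 0                         ≡⟨ cong (λ d → cutSize G S + 2 * d) (degIn-single S one v sv) ⟨
    cutSize G S + 2 * degIn S v                 ≡⟨ cut-remove S v sv ⟩
    cutSize G (remove S v) + 3                  ≡⟨ cong (_+ 3) (cut-empty _ (count-zero _ empty)) ⟩
    3                                           ∎
    where
    open ≡-Reasoning
    empty : count (remove S v) ≡ 0
    empty = count-rest S v sv one

  cut-remove-leaf : (S : VSet G) (v : Fin (V G)) → S v ≡ true → degIn S v ≤ 1 →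
    suc (cutSize G (remove S v)) ≤ cutSize G S
  cut-remove-leaf S v sv d≤1 = arith (cutSize G S) (degIn S v) (cutSize G (remove S v)) (cut-remove S v sv) d≤1
    where
    arith : ∀ c d c' → c + 2 * d ≡ c' + 3 → d ≤ 1 → suc c' ≤ c
    arith c zero c' e _ = begin
      suc c'   ≡⟨ +-comm 1 c' ⟩
      c' + 1   ≤⟨ +-monoʳ-≤ c' (s≤s (z≤n {2})) ⟩
      c' + 3   ≡⟨ e ⟨
      c + 0    ≡⟨ +-identityʳ c ⟩
      c        ∎
      where open ≤-Reasoning
    arith c (suc zero) c' e _ = ≤-reflexive (+-cancelʳ-≡ 2 (suc c') c (trans (sym (+-suc c' 2)) (sym e)))
    arith c (suc (suc d)) c' e (s≤s ())

  cycle-or-large-cut : ∀ n (S : VSet G) → count S ≡ suc n → Cycle G S ⊎ (count S + 2 ≤ cutSize G S)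
  cycle-or-large-cut n S size with any? (λ v → (S v Bool.≟ true) ×-dec (degIn S v ≤? 1))
  ... | no no-leaf = inj₁ (MinDegreeTwo.cycle S deg≥2 (proj₁ v₀) (proj₂ v₀))
    where
    deg≥2 : ∀ v → S v ≡ true → 2 ≤ degIn S v
    deg≥2 v sv = ≰⇒> (λ d≤1 → no-leaf (v , sv , d≤1))
    v₀ : ∃ λ v → S v ≡ true
    v₀ = count-witness S (subst (1 ≤_) (sym size) (s≤s z≤n))
  ... | yes (v , sv , d≤1) with n
  ...   | zero  = inj₂ (≤-reflexive (trans (cong (_+ 2) size) (sym (cut-singleton S size v sv))))
  ...   | suc m with cycle-or-large-cut m (remove S v) (count-rest S v sv size)
  ...     | inj₁ c = inj₁ (cycle-mono (remove S v) S (λ _ h → ∧-conicalˡ _ _ h) c)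
  ...     | inj₂ large = inj₂ (begin
    count S + 2                         ≡⟨ cong (_+ 2) (count-remove S v sv) ⟩
    suc (count (remove S v) + 2)        ≤⟨ s≤s large ⟩
    suc (cutSize G (remove S v))        ≤⟨ cut-remove-leaf S v sv d≤1 ⟩
    cutSize G S                         ∎)
    where open ≤-Reasoning

  two-vertex-degree : (S : VSet G) → count S ≡ 2 → cutSize G S ≡ 4 → (p q : Fin (V G)) → ¬ p ≡ q →
    S p ≡ true → S q ≡ true → degIn S p ≡ 1
  two-vertex-degree S two cut4 p q p≢q sp sq =
    *-cancelˡ-≡ (degIn S p) 1 2 (+-cancelˡ-≡ 4 (2 * degIn S p) 2 (begin
      4 + 2 * degIn S p                  ≡⟨ cong (_+ 2 * degIn S p) cut4 ⟨
      cutSize G S + 2 * degIn S p        ≡⟨ cut-remove S p sp ⟩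
      cutSize G (remove S p) + 3         ≡⟨ cong (_+ 3) (cut-singleton _ rest q (remove-keeps S sq p≢q)) ⟩
      3 + 3                              ∎))
    where
    open ≡-Reasoning
    rest : count (remove S p) ≡ 1
    rest = count-rest S p sp two

  two-vertex-edge : (S : VSet G) → count S ≡ 2 → cutSize G S ≡ 4 → IsoInduced K2 G S
  two-vertex-edge S two cut4 with count-two-witnesses S two
  ... | p , q , p≢q , sp , sq
    with count-witness (λ f → insideB G S f ∧ incidentB G p f)
                       (≤-reflexive (sym (two-vertex-degree S two cut4 p q p≢q sp sq)))
  ... | ε , ε-at-p = record
    { vmap = vmap ; vmap-inj = vmap-inj ; vmap-in = vmap-in ; vmap-on = vmap-on
    ; emap = λ _ → ε ; emap-inj = λ { {zero} {zero} _ → refl } ; emap-on = emap-on ; resp = λ _ → ε-joins }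
    where
    joins-pq : ∀ f → insideB G S f ≡ true → Joins G f p q
    joins-pq = two-vertex-joins S two p q p≢q sp sq
    ε-joins : Joins G ε p q
    ε-joins = joins-pq ε (∧-conicalˡ _ _ ε-at-p)
    emap-on : ∀ f → insideB G S f ≡ true → ∃ λ (g : Fin 1) → ε ≡ f
    emap-on f h = zero , count-one _ (two-vertex-degree S two cut4 p q p≢q sp sq) ε f ε-at-p
                                   (cong₂ _∧_ h (joins-incident (joins-pq f h)))
    vmap : Fin 2 → Fin (V G)
    vmap zero       = p
    vmap (suc zero) = q
    vmap-inj : Injective _≡_ _≡_ vmap
    vmap-inj {zero}     {zero}     _ = refl
    vmap-inj {zero}     {suc zero} e = ⊥-elim (p≢q e)
    vmap-inj {suc zero} {zero}     e = ⊥-elim (p≢q (sym e))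
    vmap-inj {suc zero} {suc zero} _ = refl
    vmap-in : ∀ x → S (vmap x) ≡ true
    vmap-in zero       = sp
    vmap-in (suc zero) = sq
    vmap-on : ∀ y → S y ≡ true → ∃ λ x → vmap x ≡ y
    vmap-on y sy with count-two-cases S two p q y sp sq p≢q sy
    ... | inj₁ e = zero , sym e
    ... | inj₂ e = suc zero , sym e

  degIn-leaving : (S : VSet G) {c : Fin (E G)} {x y : Fin (V G)} → Joins G c x y →
    insideB G S c ≡ false → degIn S x ≤ 2
  degIn-leaving S {c} {x} c-joins c-out = ≤-pred (begin
    suc (degIn S x)                                       ≡⟨ cong suc (count-ext (λ f → ∧-comm (insideB G S f) _)) ⟩
    suc (count (λ f → incidentB G x f ∧ insideB G S f))   ≤⟨ count-miss _ _ c (joins-incident c-joins) c-out ⟩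
    deg G x                                               ≡⟨ cubic x ⟩
    3                                                     ∎)
    where open ≤-Reasoning

-- Two single edges joined by two disjoint edges form a 4-cycle: with u' the
-- end of the first edge other than u, and v' likewise, the 4-cycle u u' v' v
-- is isomorphic to joinG K2 K2 u u' v v', by an involution of the vertices.

opposite : Fin 2 → Fin 2
opposite zero       = suc zero
opposite (suc zero) = zero

opposite-unique : (u u' : Fin 2) → ¬ u ≡ u' → u' ≡ opposite u
opposite-unique zero       zero       u≢u' = ⊥-elim (u≢u' refl)
opposite-unique zero       (suc zero) _    = refl
opposite-unique (suc zero) zero       _    = refl
opposite-unique (suc zero) (suc zero) u≢u' = ⊥-elim (u≢u' refl)

c4-vmap : Fin 2 → Fin 2 → Fin 4 → Fin 4
c4-vmap u v zero                   = u ↑ˡ 2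
c4-vmap u v (suc zero)             = opposite u ↑ˡ 2
c4-vmap u v (suc (suc zero))       = 2 ↑ʳ opposite v
c4-vmap u v (suc (suc (suc zero))) = 2 ↑ʳ v

c4-vmap-involutive : ∀ u v x → c4-vmap u v (c4-vmap u v x) ≡ x
c4-vmap-involutive zero       v          zero                   = refl
c4-vmap-involutive (suc zero) v          zero                   = refl
c4-vmap-involutive zero       v          (suc zero)             = refl
c4-vmap-involutive (suc zero) v          (suc zero)             = refl
c4-vmap-involutive u          zero       (suc (suc zero))       = refl
c4-vmap-involutive u          (suc zero) (suc (suc zero))       = refl
c4-vmap-involutive u          zero       (suc (suc (suc zero))) = refl
c4-vmap-involutive u          (suc zero) (suc (suc (suc zero))) = refl

-- C4 edges uu', u'v', v'v, vu go to the first edge, the second new edge,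
-- the second edge and the first new edge of the join
c4-emap c4-einv : Fin 4 → Fin 4
c4-emap zero                   = suc (suc zero)
c4-emap (suc zero)             = suc zero
c4-emap (suc (suc zero))       = suc (suc (suc zero))
c4-emap (suc (suc (suc zero))) = zero
c4-einv zero                   = suc (suc (suc zero))
c4-einv (suc zero)             = suc zero
c4-einv (suc (suc zero))       = zero
c4-einv (suc (suc (suc zero))) = suc (suc zero)

c4-einv-emap : ∀ f → c4-einv (c4-emap f) ≡ f
c4-einv-emap zero                   = refl
c4-einv-emap (suc zero)             = refl
c4-einv-emap (suc (suc zero))       = refl
c4-einv-emap (suc (suc (suc zero))) = refl

c4-emap-einv : ∀ f → c4-emap (c4-einv f) ≡ f
c4-emap-einv zero                   = refl
c4-emap-einv (suc zero)             = refl
c4-emap-einv (suc (suc zero))       = refl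
c4-emap-einv (suc (suc (suc zero))) = refl

c4-resp : ∀ u v f → Joins (joinG K2 K2 u (opposite u) v (opposite v)) (c4-emap f)
                          (c4-vmap u v (proj₁ (ends C4 f))) (c4-vmap u v (proj₂ (ends C4 f)))
c4-resp zero       v          zero                   = inj₁ refl
c4-resp (suc zero) v          zero                   = inj₂ refl
c4-resp u          v          (suc zero)             = inj₁ refl
c4-resp u          zero       (suc (suc zero))       = inj₂ refl
c4-resp u          (suc zero) (suc (suc zero))       = inj₁ refl
c4-resp u          v          (suc (suc (suc zero))) = inj₂ refl

c4-as-join : (u v : Fin 2) → Iso C4 (joinG K2 K2 u (opposite u) v (opposite v))
c4-as-join u v = record
  { vmap = c4-vmap u v ; vinv = c4-vmap u v ; vinvˡ = c4-vmap-involutive u v ; vinvʳ = c4-vmap-involutive u v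
  ; emap = c4-emap ; einv = c4-einv ; einvˡ = c4-einv-emap ; einvʳ = c4-emap-einv ; resp = c4-resp u v }

edge-join-edge : (u u' : Fin 2) → ¬ u ≡ u' → (v v' : Fin 2) → ¬ v ≡ v' → TwistedNet (joinG K2 K2 u u' v v')
edge-join-edge u u' u≢u' v v' v≢v' =
  subst₂ (λ a b → TwistedNet (joinG K2 K2 u a v b)) (sym (opposite-unique u u' u≢u')) (sym (opposite-unique v v' v≢v'))
         (iso c4 (c4-as-join u v))

module Decomposition (G : Graph) (loopless : Loopless G) (cubic : Cubic G)
                     (connected : CyclicallyFourEdgeConnected G) where
  open GraphFacts G
  open CubicFacts G loopless cubic

  -- a set of at least two vertices disjoint from a cycle has at least four
  -- edges leaving it: either it carries a cycle itself (cyclic connectivity)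
  -- or its cut has at least |S| + 2 edges
  cut≥4 : (A : VSet G) → Cycle G A → (S : VSet G) → (∀ v → S v ≡ true → A v ≡ false) →
    2 ≤ count S → 4 ≤ cutSize G S
  cut≥4 A cycle-A S S∩A two with count S in size
  ... | suc n with cycle-or-large-cut n S size
  ...   | inj₁ cycle-S = connected S (cycle-S , cycle-mono A (compl {G} S) A⊆V∖S cycle-A)
    where
    A⊆V∖S : ∀ v → A v ≡ true → not (S v) ≡ true
    A⊆V∖S v av = cong not (disjoint-sym S∩A v av)
  ...   | inj₂ large = ≤-trans (+-monoˡ-≤ 2 two) (subst (λ k → k + 2 ≤ cutSize G S) size large)

  degIn≥2 : (A : VSet G) → Cycle G A → (S : VSet G) → (∀ v → S v ≡ true → A v ≡ false) →
    cutSize G S ≡ 4 → 3 ≤ count S → ∀ x → S x ≡ true → 2 ≤ degIn S x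
  degIn≥2 A cycle-A S S∩A cut4 three x sx = arith (degIn S x) (cutSize G (remove S x))
    (trans (cong (_+ 2 * degIn S x) (sym cut4)) (cut-remove S x sx))
    (cut≥4 A cycle-A (remove S x) (λ v h → S∩A v (∧-conicalˡ _ _ h))
           (≤-pred (subst (3 ≤_) (count-remove S x sx) three)))
    where
    7≰6 : ¬ 7 ≤ 6
    7≰6 (s≤s (s≤s (s≤s (s≤s (s≤s (s≤s ()))))))
    arith : ∀ d c → 4 + 2 * d ≡ c + 3 → 4 ≤ c → 2 ≤ d
    arith (suc (suc d)) c _ _ = s≤s (s≤s z≤n)
    arith zero          c e c≥4 = ⊥-elim (7≰6 (≤-trans (+-monoˡ-≤ 3 c≥4) (≤-trans (≤-reflexive (sym e)) (s≤s (s≤s (s≤s (s≤s z≤n)))))))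
    arith (suc zero)    c e c≥4 = ⊥-elim (7≰6 (≤-trans (+-monoˡ-≤ 3 c≥4) (≤-reflexive (sym e))))

  Unsolid : VSet G → VSet G → Set
  Unsolid B X = (∀ v → X v ≡ true → B v ≡ true)
              × (2 ≤ count {V G} X)
              × (2 ≤ count {V G} (λ v → B v ∧ not (X v)))
              × (count {E G} (λ f → insideB G B f ∧ cutEdgeB G X f) ≡ 2)

  unsolid-ext : (B : VSet G) {X X' : VSet G} → (∀ v → X v ≡ X' v) → Unsolid B X → Unsolid B X'
  unsolid-ext B X≗X' (X⊆B , two-X , two-rest , cut2) =
      (λ v x'v → X⊆B v (trans (X≗X' v) x'v))
    , subst (2 ≤_) (count-ext X≗X') two-X
    , subst (2 ≤_) (count-ext (λ v → cong (λ b → B v ∧ not b) (X≗X' v))) two-rest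
    , trans (sym (count-ext (λ f → cong (insideB G B f ∧_) (cong₂ _xor_ (X≗X' (src f)) (X≗X' (tgt f)))))) cut2

  -- the property is decidable, so a set that is not solid has a witness
  unsolid-witness : (B : VSet G) → ¬ Solid G B → Σ (VSet G) (Unsolid B)
  unsolid-witness B not-solid with anySubset? (λ s → unsolid? (lookup s))
    where
    unsolid? : ∀ X → Dec (Unsolid B X)
    unsolid? X = all? (λ v → (X v Bool.≟ true) →-dec (B v Bool.≟ true))
           ×-dec (2 ≤? count X)
           ×-dec (2 ≤? count (λ v → B v ∧ not (X v)))
           ×-dec (count {E G} (λ f → insideB G B f ∧ cutEdgeB G X f) ℕ.≟ 2)
  ... | yes (s , u) = lookup s , u
  ... | no none = ⊥-elim (not-solid (λ (X , u) →
                    none (tabulate X , unsolid-ext B (λ v → sym (lookup∘tabulate X v)) u)))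

  record Split : Set where
    field
      A X Y     : VSet G
      cycle-A   : Cycle G A
      X∩A       : ∀ v → X v ≡ true → A v ≡ false
      Y∩A       : ∀ v → Y v ≡ true → A v ≡ false
      X∩Y       : ∀ v → X v ≡ true → Y v ≡ false
      covers    : ∀ v → A v ≡ false → (X v ≡ true) ⊎ (Y v ≡ true)
      cut-X     : cutSize G X ≡ 4
      cut-Y     : cutSize G Y ≡ 4
      two-X     : 2 ≤ count X
      two-Y     : 2 ≤ count Y
      c₁ c₂     : Fin (E G)
      c₁≢c₂     : ¬ c₁ ≡ c₂
      x₁ y₁ x₂ y₂ : Fin (V G)
      x₁∈X      : X x₁ ≡ true
      y₁∈Y      : Y y₁ ≡ true
      x₂∈X      : X x₂ ≡ true
      y₂∈Y      : Y y₂ ≡ true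
      c₁-joins  : Joins G c₁ x₁ y₁
      c₂-joins  : Joins G c₂ x₂ y₂
      edges     : ∀ f → insideB G (compl {G} A) f ≡ true →
                  (insideB G X f ≡ true) ⊎ (insideB G Y f ≡ true) ⊎ (f ≡ c₁) ⊎ (f ≡ c₂)

  swap : Split → Split
  swap s = record
    { A = A ; X = Y ; Y = X ; cycle-A = cycle-A ; X∩A = Y∩A ; Y∩A = X∩A ; X∩Y = disjoint-sym X∩Y
    ; covers = λ v av → swap⊎ (covers v av)
    ; cut-X = cut-Y ; cut-Y = cut-X ; two-X = two-Y ; two-Y = two-X
    ; c₁ = c₁ ; c₂ = c₂ ; c₁≢c₂ = c₁≢c₂ ; x₁ = y₁ ; y₁ = x₁ ; x₂ = y₂ ; y₂ = x₂
    ; x₁∈X = y₁∈Y ; y₁∈Y = x₁∈X ; x₂∈X = y₂∈Y ; y₂∈Y = x₂∈X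
    ; c₁-joins = joins-sym c₁-joins ; c₂-joins = joins-sym c₂-joins
    ; edges = λ f h → swap-first (edges f h) }
    where
    open Split s
    swap⊎ : ∀ {P Q : Set} → P ⊎ Q → Q ⊎ P
    swap⊎ (inj₁ p) = inj₂ p
    swap⊎ (inj₂ q) = inj₁ q
    swap-first : ∀ {P Q R : Set} → P ⊎ Q ⊎ R → Q ⊎ P ⊎ R
    swap-first (inj₁ p)        = inj₂ (inj₁ p)
    swap-first (inj₂ (inj₁ q)) = inj₁ q
    swap-first (inj₂ (inj₂ r)) = inj₂ (inj₂ r)

  -- A witness X of non-solidity of V∖A, for a cyclic 4-edge-cut E(A, V∖A),
  -- yields a split with Y = V∖(A ∪ X): |∂X| + |∂Y| = |∂A| + 2·2 = 8 and both
  -- are at least 4.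
  module Splitting (A : VSet G) (cyclic4 : Cyclic4Cut G A) (X : VSet G)
                   (unsolid : Unsolid (compl {G} A) X) where
    cycle-A : Cycle G A
    cycle-A = proj₁ (proj₁ cyclic4)

    Y : VSet G
    Y v = not (A v) ∧ not (X v)

    X∩A : ∀ v → X v ≡ true → A v ≡ false
    X∩A v xv with A v | proj₁ unsolid v xv
    ... | false | _ = refl

    Y∩A : ∀ v → Y v ≡ true → A v ≡ false
    Y∩A v yv with A v | yv
    ... | false | _ = refl

    X∩Y : ∀ v → X v ≡ true → Y v ≡ false
    X∩Y v xv rewrite xv = ∧-zeroʳ (not (A v))

    covers : ∀ v → A v ≡ false → (X v ≡ true) ⊎ (Y v ≡ true)
    covers v av with X v
    ... | true  = inj₁ refl
    ... | false rewrite av = inj₂ refl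

    two-X : 2 ≤ count X
    two-X = proj₁ (proj₂ unsolid)

    two-Y : 2 ≤ count Y
    two-Y = proj₁ (proj₂ (proj₂ unsolid))

    cross : Fin (E G) → Bool
    cross f = insideB G (compl {G} A) f ∧ cutEdgeB G X f

    cross-two : count cross ≡ 2
    cross-two = proj₂ (proj₂ (proj₂ unsolid))

    cuts : (cutSize G X ≡ 4) × (cutSize G Y ≡ 4)
    cuts = both-four (cut≥4 A cycle-A X X∩A two-X) (cut≥4 A cycle-A Y Y∩A two-Y)
      (trans (sym (cut-three-parts A X X∩A)) (cong₂ (λ a b → a + 2 * b) (proj₂ cyclic4) cross-two))
      where
      both-four : ∀ {a b} → 4 ≤ a → 4 ≤ b → a + b ≡ 8 → (a ≡ 4) × (b ≡ 4)
      both-four {a} {b} a≥4 b≥4 e =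
          ≤-antisym (+-cancelʳ-≤ b a 4 (≤-trans (≤-reflexive e) (+-monoʳ-≤ 4 b≥4))) a≥4
        , ≤-antisym (+-cancelˡ-≤ a b 4 (≤-trans (≤-reflexive e) (+-monoˡ-≤ 4 a≥4))) b≥4

    crossing : Σ (Fin (E G)) λ c₁ → Σ (Fin (E G)) λ c₂ → (¬ c₁ ≡ c₂) × (cross c₁ ≡ true) × (cross c₂ ≡ true)
    crossing = count-two-witnesses cross cross-two

    c₁ c₂ : Fin (E G)
    c₁ = proj₁ crossing
    c₂ = proj₁ (proj₂ crossing)

    crossing-edge : ∀ f → cross f ≡ true → (f ≡ c₁) ⊎ (f ≡ c₂)
    crossing-edge f = count-two-cases cross cross-two c₁ c₂ f
      (proj₁ (proj₂ (proj₂ (proj₂ crossing)))) (proj₂ (proj₂ (proj₂ (proj₂ crossing)))) (proj₁ (proj₂ (proj₂ crossing)))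

    record Crossing (f : Fin (E G)) : Set where
      field
        x y   : Fin (V G)
        x∈X   : X x ≡ true
        y∈Y   : Y y ≡ true
        joins : Joins G f x y

    crossing-ends : ∀ f → cross f ≡ true → Crossing f
    crossing-ends f h with A (src f) in as | A (tgt f) in at | X (src f) in xs | X (tgt f) in xt | h
    ... | false | false | true  | false | _ = record
      { x = src f ; y = tgt f ; x∈X = xs ; y∈Y = cong₂ _∧_ (cong not at) (cong not xt) ; joins = inj₁ refl }
    ... | false | false | false | true  | _ = record
      { x = tgt f ; y = src f ; x∈X = xt ; y∈Y = cong₂ _∧_ (cong not as) (cong not xs) ; joins = inj₂ refl }
    ... | false | false | true  | true  | ()
    ... | false | false | false | false | ()
    ... | true  | _     | _     | _     | ()
    ... | false | true  | _     | _     | ()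

    edges : ∀ f → insideB G (compl {G} A) f ≡ true →
      (insideB G X f ≡ true) ⊎ (insideB G Y f ≡ true) ⊎ (f ≡ c₁) ⊎ (f ≡ c₂)
    edges f h with X (src f) in xs | X (tgt f) in xt
    ... | true  | true  = inj₁ refl
    ... | false | false = inj₂ (inj₁ (in-Y {not (A (src f))} {not (A (tgt f))} h))
      where
      in-Y : ∀ {a b} → a ∧ b ≡ true → (a ∧ true) ∧ (b ∧ true) ≡ true
      in-Y {true} {true} _ = refl
    ... | true  | false = inj₂ (inj₂ (crossing-edge f (cong₂ _∧_ h (cong₂ _xor_ xs xt))))
    ... | false | true  = inj₂ (inj₂ (crossing-edge f (cong₂ _∧_ h (cong₂ _xor_ xs xt))))

    module End₁ = Crossing (crossing-ends c₁ (proj₁ (proj₂ (proj₂ (proj₂ crossing)))))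
    module End₂ = Crossing (crossing-ends c₂ (proj₂ (proj₂ (proj₂ (proj₂ crossing)))))

    split : Split
    split = record
      { A = A ; X = X ; Y = Y ; cycle-A = cycle-A ; X∩A = X∩A ; Y∩A = Y∩A ; X∩Y = X∩Y ; covers = covers
      ; cut-X = proj₁ cuts ; cut-Y = proj₂ cuts ; two-X = two-X ; two-Y = two-Y
      ; c₁ = c₁ ; c₂ = c₂ ; c₁≢c₂ = proj₁ (proj₂ (proj₂ crossing))
      ; x₁ = End₁.x ; y₁ = End₁.y ; x₂ = End₂.x ; y₂ = End₂.y
      ; x₁∈X = End₁.x∈X ; y₁∈Y = End₁.y∈Y ; x₂∈X = End₂.x∈X ; y₂∈Y = End₂.y∈Y
      ; c₁-joins = End₁.joins ; c₂-joins = End₂.joins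
      ; edges = edges }

  module SplitFacts (s : Split) where
    open Split s

    sizes : count X + count Y ≡ count (compl {G} A)
    sizes = count-partition X Y (compl {G} A) pointwise
      where
      pointwise : ∀ v → ind (X v) + ind (Y v) ≡ ind (not (A v))
      pointwise v with X v in xv
      ... | true rewrite X∩Y v xv | X∩A v xv = refl
      ... | false with A v in av
      ...   | true rewrite disjoint-sym Y∩A v av = refl
      ...   | false with covers v av
      ...     | inj₁ xv' with () ← trans (sym xv) xv'
      ...     | inj₂ yv rewrite yv = refl

    -- the end x in X of an edge to Y has degree at most two in G[X], as the
    -- edge leaves X, and at least two when |X| ≥ 3; so it is a corner of G[X]
    attachment-corner : ∀ {c x y} → Joins G c x y → X x ≡ true → Y y ≡ true → 3 ≤ count X →
      degIn X x ≡ 2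
    attachment-corner c-joins xx yy three = ≤-antisym
      (degIn-leaving X c-joins (joins-leaves X c-joins (disjoint-sym X∩Y _ yy)))
      (degIn≥2 A cycle-A X X∩A cut-X three _ xx)

    x₁-corner : 3 ≤ count X → degIn X x₁ ≡ 2
    x₁-corner = attachment-corner c₁-joins x₁∈X y₁∈Y

    x₂-corner : 3 ≤ count X → degIn X x₂ ≡ 2
    x₂-corner = attachment-corner c₂-joins x₂∈X y₂∈Y

    -- x₁ ≠ x₂: otherwise adding x₁ to Y would give a set with ≥ 2 vertices,
    -- disjoint from the cycle in A, whose cut has only 4 + 3 − 2·2 = 3 edges
    x₁≢x₂ : ¬ x₁ ≡ x₂
    x₁≢x₂ refl = <⇒≱ (s≤s small) (cut≥4 A cycle-A S S∩A two-S)
      where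
      S : VSet G
      S v = Y v ∨ v =ᵇ x₁
      x₁∈S : S x₁ ≡ true
      x₁∈S rewrite X∩Y x₁ x₁∈X = =ᵇ-refl x₁
      Y⊆S : ∀ {v} → Y v ≡ true → S v ≡ true
      Y⊆S yv = cong (_∨ _) yv
      S∖x₁≗Y : ∀ v → remove S x₁ v ≡ Y v
      S∖x₁≗Y v with v =ᵇ x₁ in e
      ... | true  = trans (∧-zeroʳ _) (sym (subst (λ z → Y z ≡ false) (sym (=ᵇ-sound e)) (X∩Y x₁ x₁∈X)))
      ... | false = trans (∧-identityʳ _) (∨-identityʳ _)
      S∩A : ∀ v → S v ≡ true → A v ≡ false
      S∩A v h with Y v in yv
      ... | true  = Y∩A v yv
      ... | false = subst (λ z → A z ≡ false) (sym (=ᵇ-sound h)) (X∩A x₁ x₁∈X)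
      two-S : 2 ≤ count S
      two-S = ≤-trans two-Y (count-mono Y S (λ v → Y⊆S))
      c-at-x₁ : ∀ {c y} → Joins G c x₁ y → Y y ≡ true → insideB G S c ∧ incidentB G x₁ c ≡ true
      c-at-x₁ c-joins yy = cong₂ _∧_ (joins-inside⇐ S c-joins x₁∈S (Y⊆S yy)) (joins-incident c-joins)
      two-edges : 2 ≤ degIn S x₁
      two-edges = count-two _ c₁ c₂ (c-at-x₁ c₁-joins y₁∈Y) (c-at-x₁ c₂-joins y₂∈Y) c₁≢c₂
      small : cutSize G S ≤ 3
      small = +-cancelʳ-≤ 4 (cutSize G S) 3 (begin
        cutSize G S + 4                   ≤⟨ +-monoʳ-≤ (cutSize G S) (*-monoʳ-≤ 2 two-edges) ⟩
        cutSize G S + 2 * degIn S x₁      ≡⟨ cut-remove S x₁ x₁∈S ⟩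
        cutSize G (remove S x₁) + 3       ≡⟨ cong (_+ 3) (trans (cut-ext _ _ S∖x₁≗Y) cut-Y) ⟩
        3 + 4                             ∎)
        where open ≤-Reasoning

    c₁-outside-X : insideB G X c₁ ≡ false
    c₁-outside-X = joins-leaves X c₁-joins (disjoint-sym X∩Y y₁ y₁∈Y)

    c₂-outside-X : insideB G X c₂ ≡ false
    c₂-outside-X = joins-leaves X c₂-joins (disjoint-sym X∩Y y₂ y₂∈Y)

    c₁-outside-Y : insideB G Y c₁ ≡ false
    c₁-outside-Y = joins-leaves Y (joins-sym c₁-joins) (X∩Y x₁ x₁∈X)

    c₂-outside-Y : insideB G Y c₂ ≡ false
    c₂-outside-Y = joins-leaves Y (joins-sym c₂-joins) (X∩Y x₂ x₂∈X)

  module Glue (s : Split) {HX HY : Graph}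
              (IX : IsoInduced HX G (Split.X s)) (IY : IsoInduced HY G (Split.Y s))
              (u u' : Fin (V HX)) (v v' : Fin (V HY))
              (u↦x₁ : IsoInduced.vmap IX u ≡ Split.x₁ s) (u'↦x₂ : IsoInduced.vmap IX u' ≡ Split.x₂ s)
              (v↦y₁ : IsoInduced.vmap IY v ≡ Split.y₁ s) (v'↦y₂ : IsoInduced.vmap IY v' ≡ Split.y₂ s) where
    open Split s
    open SplitFacts s
    module IX = IsoInduced IX
    module IY = IsoInduced IY

    J : Graph
    J = joinG HX HY u u' v v'

    sideV : Fin (V HX) ⊎ Fin (V HY) → Fin (V G)
    sideV (inj₁ a) = IX.vmap a
    sideV (inj₂ b) = IY.vmap b

    vmap : Fin (V J) → Fin (V G)
    vmap i = sideV (splitAt (V HX) i)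

    vmap-left : ∀ a → vmap (a ↑ˡ V HY) ≡ IX.vmap a
    vmap-left a rewrite splitAt-↑ˡ (V HX) a (V HY) = refl

    vmap-right : ∀ b → vmap (V HX ↑ʳ b) ≡ IY.vmap b
    vmap-right b rewrite splitAt-↑ʳ (V HX) (V HY) b = refl

    sideV-injective : ∀ p q → sideV p ≡ sideV q → p ≡ q
    sideV-injective (inj₁ a) (inj₁ b) e = cong inj₁ (IX.vmap-inj e)
    sideV-injective (inj₂ a) (inj₂ b) e = cong inj₂ (IY.vmap-inj e)
    sideV-injective (inj₁ a) (inj₂ b) e with () ←
      trans (sym (IY.vmap-in b)) (trans (cong Y (sym e)) (X∩Y _ (IX.vmap-in a)))
    sideV-injective (inj₂ a) (inj₁ b) e with () ←
      trans (sym (IY.vmap-in a)) (trans (cong Y e) (X∩Y _ (IX.vmap-in b)))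

    vmap-inj : Injective _≡_ _≡_ vmap
    vmap-inj {i} {j} e = begin
      i                                  ≡⟨ join-splitAt (V HX) (V HY) i ⟨
      join (V HX) (V HY) (splitAt _ i)   ≡⟨ cong (join (V HX) (V HY)) (sideV-injective (splitAt (V HX) i) (splitAt (V HX) j) e) ⟩
      join (V HX) (V HY) (splitAt _ j)   ≡⟨ join-splitAt (V HX) (V HY) j ⟩
      j                                  ∎
      where open ≡-Reasoning

    sideV-outside-A : ∀ p → A (sideV p) ≡ false
    sideV-outside-A (inj₁ a) = X∩A _ (IX.vmap-in a)
    sideV-outside-A (inj₂ b) = Y∩A _ (IY.vmap-in b)

    vmap-in : ∀ i → compl {G} A (vmap i) ≡ true
    vmap-in i = cong not (sideV-outside-A (splitAt (V HX) i))

    vmap-on : ∀ y → compl {G} A y ≡ true → ∃ λ i → vmap i ≡ y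
    vmap-on y h with covers y (trans (sym (not-involutive (A y))) (cong not h))
    ... | inj₁ xy = let (a , e) = IX.vmap-on y xy in (a ↑ˡ V HY) , trans (vmap-left a) e
    ... | inj₂ yy = let (b , e) = IY.vmap-on y yy in (V HX ↑ʳ b) , trans (vmap-right b) e

    sideE : Fin (E HX) ⊎ Fin (E HY) → Fin (E G)
    sideE (inj₁ g) = IX.emap g
    sideE (inj₂ g) = IY.emap g

    emap : Fin (E J) → Fin (E G)
    emap zero          = c₁
    emap (suc zero)    = c₂
    emap (suc (suc f)) = sideE (splitAt (E HX) f)

    IX-inside : ∀ g → insideB G X (IX.emap g) ≡ true
    IX-inside g = joins-inside⇐ X (IX.resp g) (IX.vmap-in _) (IX.vmap-in _)

    IY-inside : ∀ g → insideB G Y (IY.emap g) ≡ true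
    IY-inside g = joins-inside⇐ Y (IY.resp g) (IY.vmap-in _) (IY.vmap-in _)

    not-sideE : ∀ c → insideB G X c ≡ false → insideB G Y c ≡ false → ∀ p → ¬ c ≡ sideE p
    not-sideE c c∉X c∉Y (inj₁ g) refl with () ← trans (sym (IX-inside g)) c∉X
    not-sideE c c∉X c∉Y (inj₂ g) refl with () ← trans (sym (IY-inside g)) c∉Y

    sideE-injective : ∀ p q → sideE p ≡ sideE q → p ≡ q
    sideE-injective (inj₁ a) (inj₁ b) e = cong inj₁ (IX.emap-inj e)
    sideE-injective (inj₂ a) (inj₂ b) e = cong inj₂ (IY.emap-inj e)
    sideE-injective (inj₁ a) (inj₂ b) e with () ←
      trans (sym (IY-inside b)) (trans (cong (insideB G Y) (sym e)) (inside-disjoint X Y X∩Y _ (IX-inside a)))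
    sideE-injective (inj₂ a) (inj₁ b) e with () ←
      trans (sym (IY-inside a)) (trans (cong (insideB G Y) e) (inside-disjoint X Y X∩Y _ (IX-inside b)))

    c₁-new : ∀ p → ¬ c₁ ≡ sideE p
    c₁-new = not-sideE c₁ c₁-outside-X c₁-outside-Y
    c₂-new : ∀ p → ¬ c₂ ≡ sideE p
    c₂-new = not-sideE c₂ c₂-outside-X c₂-outside-Y

    emap-inj : Injective _≡_ _≡_ emap
    emap-inj {zero}        {zero}        e = refl
    emap-inj {zero}        {suc zero}    e = ⊥-elim (c₁≢c₂ e)
    emap-inj {zero}        {suc (suc g)} e = ⊥-elim (c₁-new (splitAt (E HX) g) e)
    emap-inj {suc zero}    {zero}        e = ⊥-elim (c₁≢c₂ (sym e))
    emap-inj {suc zero}    {suc zero}    e = refl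
    emap-inj {suc zero}    {suc (suc g)} e = ⊥-elim (c₂-new (splitAt (E HX) g) e)
    emap-inj {suc (suc f)} {zero}        e = ⊥-elim (c₁-new (splitAt (E HX) f) (sym e))
    emap-inj {suc (suc f)} {suc zero}    e = ⊥-elim (c₂-new (splitAt (E HX) f) (sym e))
    emap-inj {suc (suc f)} {suc (suc g)} e = cong (λ z → suc (suc z)) (begin
      f                                  ≡⟨ join-splitAt (E HX) (E HY) f ⟨
      join (E HX) (E HY) (splitAt _ f)   ≡⟨ cong (join (E HX) (E HY)) (sideE-injective (splitAt (E HX) f) (splitAt (E HX) g) e) ⟩
      join (E HX) (E HY) (splitAt _ g)   ≡⟨ join-splitAt (E HX) (E HY) g ⟩
      g                                  ∎)
      where open ≡-Reasoning

    emap-on : ∀ f → insideB G (compl {G} A) f ≡ true → ∃ λ i → emap i ≡ f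
    emap-on f h with edges f h
    ... | inj₁ in-X = let (g , e) = IX.emap-on f in-X in
      suc (suc (g ↑ˡ E HY)) , trans (cong sideE (splitAt-↑ˡ (E HX) g (E HY))) e
    ... | inj₂ (inj₁ in-Y) = let (g , e) = IY.emap-on f in-Y in
      suc (suc (E HX ↑ʳ g)) , trans (cong sideE (splitAt-↑ʳ (E HX) (E HY) g)) e
    ... | inj₂ (inj₂ (inj₁ f≡c₁)) = zero , sym f≡c₁
    ... | inj₂ (inj₂ (inj₂ f≡c₂)) = suc zero , sym f≡c₂

    resp : ∀ f → Joins G (emap f) (vmap (proj₁ (ends J f))) (vmap (proj₂ (ends J f)))
    resp zero       rewrite vmap-left u  | vmap-right v  | u↦x₁  | v↦y₁  = c₁-joins
    resp (suc zero) rewrite vmap-left u' | vmap-right v' | u'↦x₂ | v'↦y₂ = c₂-joins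
    resp (suc (suc f)) with splitAt (E HX) f
    ... | inj₁ g rewrite vmap-left (proj₁ (ends HX g)) | vmap-left (proj₂ (ends HX g)) = IX.resp g
    ... | inj₂ g rewrite vmap-right (proj₁ (ends HY g)) | vmap-right (proj₂ (ends HY g)) = IY.resp g

    glued : IsoInduced J G (compl {G} A)
    glued = record { vmap = vmap ; vmap-inj = vmap-inj ; vmap-in = vmap-in ; vmap-on = vmap-on
                   ; emap = emap ; emap-inj = emap-inj ; emap-on = emap-on ; resp = resp }

  module SplitSides (s : Split) where
    open Split s
    open SplitFacts s

    -- a side with at least three vertices carries a cycle, since its cut has
    -- only 4 < |X| + 2 edges; so V∖X is the near side of a cyclic 4-edge-cut
    far-side-cut : 3 ≤ count X → Cyclic4Cut G (compl {G} X)
    far-side-cut three with count X in size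
    ... | suc n with cycle-or-large-cut n X size
    ...   | inj₁ cycle-X = (cycle-mono A (compl {G} X) A⊆V∖X cycle-A , cycle-mono X _ X⊆X cycle-X)
                         , trans (cut-compl X) cut-X
      where
      A⊆V∖X : ∀ v → A v ≡ true → not (X v) ≡ true
      A⊆V∖X v av = cong not (disjoint-sym X∩A v av)
      X⊆X : ∀ v → X v ≡ true → not (not (X v)) ≡ true
      X⊆X v xv = trans (not-involutive (X v)) xv
    ...   | inj₂ large = ⊥-elim (5≰4 (≤-trans (+-monoˡ-≤ 2 three)
                           (≤-trans (subst (λ k → k + 2 ≤ cutSize G X) size large) (≤-reflexive cut-X))))
      where
      5≰4 : ¬ 5 ≤ 4
      5≰4 (s≤s (s≤s (s≤s (s≤s ()))))

    inside-far-side : ∀ f → insideB G A f ≡ true → insideB G (compl {G} X) f ≡ true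
    inside-far-side f h = cong₂ _∧_ (cong not (disjoint-sym X∩A _ (∧-conicalˡ _ _ h)))
                                    (cong not (disjoint-sym X∩A _ (∧-conicalʳ _ _ h)))

    -- X is strictly smaller than V∖A, since Y is nonempty
    X-smaller : ∀ n → count (compl {G} A) ≤ suc n → count X ≤ n
    X-smaller n size = ≤-pred (begin
      suc (count X)             ≡⟨ +-comm 1 (count X) ⟩
      count X + 1               ≤⟨ +-monoʳ-≤ (count X) (≤-trans (s≤s z≤n) two-Y) ⟩
      count X + count Y         ≡⟨ sizes ⟩
      count (compl {G} A)       ≤⟨ size ⟩
      suc n                     ∎)
      where open ≤-Reasoning

module NetInduction (G : Graph) (loopless : Loopless G) (cubic : Cubic G)
                    (connected : CyclicallyFourEdgeConnected G) (e : Fin (E G))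
                    (not-solid : ∀ (A : VSet G) → Cyclic4Cut G A → insideB G A e ≡ true →
                                 ¬ Solid G (compl {G} A)) where
  open GraphFacts G
  open CubicFacts G loopless cubic
  open Decomposition G loopless cubic connected

  NetsUpTo : ℕ → Set
  NetsUpTo n = ∀ (A : VSet G) → count (compl {G} A) ≤ n → Cyclic4Cut G A → insideB G A e ≡ true →
               InducedTwistedNet G (compl {G} A)

  data SideNet (X : VSet G) (x₁ x₂ : Fin (V G)) : Set where
    single-edge : IsoInduced K2 G X → SideNet X x₁ x₂
    net         : (H : Graph) → TwistedNet H → IsoInduced H G X →
                  degIn X x₁ ≡ 2 → degIn X x₂ ≡ 2 → SideNet X x₁ x₂

  module Sides (s : Split) (e∈A : insideB G (Split.A s) e ≡ true) where
    open Split s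
    open SplitFacts s
    open SplitSides s

    -- a side with two vertices is a single edge; a larger side X is the far
    -- side of the smaller cyclic 4-edge-cut E(V∖X, X), whose near side contains e
    side-net : ∀ n → count X ≤ n → NetsUpTo n → SideNet X x₁ x₂
    side-net n small nets-n with count X ℕ.≟ 2
    ... | yes two = single-edge (two-vertex-edge X two cut-X)
    ... | no ≢2   = larger (≤∧≢⇒< two-X (λ 2≡ → ≢2 (sym 2≡)))
      where
      larger : 3 ≤ count X → SideNet X x₁ x₂
      larger three
        with nets-n (compl {G} X) (subst (_≤ n) (count-ext (λ v → sym (not-involutive (X v)))) small)
                    (far-side-cut three) (inside-far-side e e∈A)
      ... | H , net-H , iso-H =
        net H net-H (iso-ext iso-H (λ v → not-involutive (X v))) (x₁-corner three) (x₂-corner three)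

  module Attachments (s : Split) {HX HY : Graph}
                     (IX : IsoInduced HX G (Split.X s)) (IY : IsoInduced HY G (Split.Y s)) where
    open Split s
    module IX = IsoInduced IX
    module IY = IsoInduced IY

    u u' : Fin (V HX)
    u  = proj₁ (IX.vmap-on x₁ x₁∈X)
    u' = proj₁ (IX.vmap-on x₂ x₂∈X)
    v v' : Fin (V HY)
    v  = proj₁ (IY.vmap-on y₁ y₁∈Y)
    v' = proj₁ (IY.vmap-on y₂ y₂∈Y)

    u↦x₁ : IX.vmap u ≡ x₁
    u↦x₁ = proj₂ (IX.vmap-on x₁ x₁∈X)
    u'↦x₂ : IX.vmap u' ≡ x₂
    u'↦x₂ = proj₂ (IX.vmap-on x₂ x₂∈X)
    v↦y₁ : IY.vmap v ≡ y₁
    v↦y₁ = proj₂ (IY.vmap-on y₁ y₁∈Y)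
    v'↦y₂ : IY.vmap v' ≡ y₂
    v'↦y₂ = proj₂ (IY.vmap-on y₂ y₂∈Y)

    u≢u' : ¬ u ≡ u'
    u≢u' u≡u' = SplitFacts.x₁≢x₂ s (trans (sym u↦x₁) (trans (cong IX.vmap u≡u') u'↦x₂))

    v≢v' : ¬ v ≡ v'
    v≢v' v≡v' = SplitFacts.x₁≢x₂ (swap s) (trans (sym v↦y₁) (trans (cong IY.vmap v≡v') v'↦y₂))

    u-corner : degIn X x₁ ≡ 2 → Corner HX u
    u-corner d = trans (deg-iso IX u) (trans (cong (degIn X) u↦x₁) d)
    u'-corner : degIn X x₂ ≡ 2 → Corner HX u'
    u'-corner d = trans (deg-iso IX u') (trans (cong (degIn X) u'↦x₂) d)
    v-corner : degIn Y y₁ ≡ 2 → Corner HY v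
    v-corner d = trans (deg-iso IY v) (trans (cong (degIn Y) v↦y₁) d)
    v'-corner : degIn Y y₂ ≡ 2 → Corner HY v'
    v'-corner d = trans (deg-iso IY v') (trans (cong (degIn Y) v'↦y₂) d)

    glued : IsoInduced (joinG HX HY u u' v v') G (compl {G} A)
    glued = Glue.glued s IX IY u u' v v' u↦x₁ u'↦x₂ v↦y₁ v'↦y₂

  glue-sides : (s : Split) → SideNet (Split.X s) (Split.x₁ s) (Split.x₂ s) →
    SideNet (Split.Y s) (Split.y₁ s) (Split.y₂ s) → InducedTwistedNet G (compl {G} (Split.A s))
  glue-sides s (net HX net-X IX dx₁ dx₂) (net HY net-Y IY dy₁ dy₂) =
    _ , joinNet net-X net-Y u u' u≢u' (u-corner dx₁) (u'-corner dx₂) v v' v≢v' (v-corner dy₁) (v'-corner dy₂)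
      , glued
    where open Attachments s IX IY
  glue-sides s (net HX net-X IX dx₁ dx₂) (single-edge IY) =
    _ , joinEdge net-X u u' u≢u' (u-corner dx₁) (u'-corner dx₂) v v' v≢v' , glued
    where open Attachments s IX IY
  glue-sides s (single-edge IX) (net HY net-Y IY dy₁ dy₂) =
    glue-sides (swap s) (net HY net-Y IY dy₁ dy₂) (single-edge IX)
  glue-sides s (single-edge IX) (single-edge IY) =
    _ , edge-join-edge u u' u≢u' v v' v≢v' , glued
    where open Attachments s IX IY

  nets : ∀ n → NetsUpTo n
  nets zero A size ((_ , cycle-B) , _) _
    with () ← ≤-trans (count-positive (compl {G} A) _ (Cycle.inA cycle-B zero)) size
  nets (suc n) A size cut e∈A with unsolid-witness (compl {G} A) (not-solid A cut e∈A)
  ... | X , unsolid =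
    glue-sides s (Sides.side-net s        e∈A n (SplitSides.X-smaller s        n size) (nets n))
                 (Sides.side-net (swap s) e∈A n (SplitSides.X-smaller (swap s) n size) (nets n))
    where
    s : Split
    s = Splitting.split A cut X unsolid

lemma26 : (G : Graph) → Loopless G → Cubic G → CyclicallyFourEdgeConnected G →
    (e : Fin (E G)) →
    (∀ (A : VSet G) → Cyclic4Cut G A → cutEdgeB G A e ≡ false) →
    (∀ (A : VSet G) → Cyclic4Cut G A → insideB G A e ≡ true → ¬ Solid G (compl {G} A)) →
    ∀ (A : VSet G) → Cyclic4Cut G A → insideB G A e ≡ true →
    InducedTwistedNet G (compl {G} A)
lemma26 G loopless cubic connected e _ not-solid A cut e∈A =
  NetInduction.nets G loopless cubic connected e not-solid (count (compl {G} A)) A ≤-refl cut e∈A
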